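{- Let $\Sigma$ be a finite alphabet of size $m$ and let $T=T[1,n]$ be a string over $\Sigma$. For $1\le i\le n$ and $\sigma\in\Sigma$ let $c_i(\sigma)=|\{j: 1\le j\le i-1,\ T[j]=\sigma\}|$ and $d_i(\sigma)=|\{j: i\le j\le n,\ T[j]=\sigma\}|$. Let $$r_b=\prod_{i=1}^{n}\frac{c_i(T[i])+1}{m+i-1},\qquad r_f=\prod_{i=1}^{n}\frac{d_i(T[i])}{n-i+1}$$ be the final range widths of backward adaptive and forward-looking arithmetic coding, respectively. Then $$-\log_2 r_b-(-\log_2 r_f)=\log_2\binom{m+n-1}{n},$$ i.e., the forward-looking encoding is shorter than the backward adaptive encoding (excluding any header) by exactly $\log_2\binom{m+n-1}{n}$ bits.
   Context: The size in bits of an arithmetic-coded file is taken as $-\log_2$ of the width of the final interval. In backward adaptive coding every symbol of $\Sigma$ has its count initialized to $1$ and the probability of $T[i]$ is computed from the prefix $T[1,i-1]$; in forward-looking coding the probability of $T[i]$ is its relative frequency in the suffix $T[i,n]$. -}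

module Defs where

open import Data.Nat using (ℕ; zero; suc; _+_; _∸_)
open import Data.Fin using (Fin)
open import Data.Fin.Properties using () renaming (_≟_ to _≟ᶠ_)
open import Data.List using (List; []; _∷_; length; take; drop)
open import Data.Integer using (+_)
open import Data.Rational using (ℚ; _/_; _*_; 1ℚ; 0ℚ)
open import Relation.Nullary using (yes; no)

count : ∀ {m} → Fin m → List (Fin m) → ℕ
count σ [] = 0
count σ (x ∷ xs) with x ≟ᶠ σ
... | yes _ = suc (count σ xs)
... | no  _ = count σ xs

-- a / b as a rational; totalised with value 0 when b = 0
-- (this case never arises in the factors below whenever they are used).
frac : ℕ → ℕ → ℚ
frac a zero    = 0ℚ
frac a (suc b) = (+ a) / suc b

-- The string T = T[1..n] is a list of symbols of Σ = Fin m.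
-- Position i (1-based) corresponds to 0-based index k = i - 1.
-- prefix T[1, i-1] = take k T ; suffix T[i, n] = drop k T.

prodFrom : ℕ → ℕ → (ℕ → ℚ) → ℚ
prodFrom k zero    f = 1ℚ
prodFrom k (suc r) f = f k * prodFrom (suc k) r f

-- Symbol at 0-based index k (used only for k < length T).
atFactor : ∀ {m} → (List (Fin m) → Fin m → ℚ) → List (Fin m) → ℕ → ℚ
atFactor g T k with drop k T
... | []    = 1ℚ
... | x ∷ _ = g (take k T) x

rb : (m : ℕ) → List (Fin m) → ℚ
rb m T = prodFrom 0 (length T) λ k →
  atFactor (λ pre x → frac (count x pre + 1) (m + k)) T k

rf : (m : ℕ) → List (Fin m) → ℚ
rf m T = prodFrom 0 (length T) λ k →
  atFactor (λ pre x → frac (count x (drop k T)) (length T ∸ k)) T k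

-- Both widths have the same numerator ∏_σ (count σ T)!, assembled in two orders: the
-- forward coder's factors for a symbol σ count down from its multiplicity, the backward
-- coder's count up from 1. Only the denominators differ: n! for the forward coder and
-- the rising factorial m (m + 1) ⋯ (m + n − 1) = C(m + n − 1, n) · n! for the backward one.
module Submission where

open import Defs
open import Data.Nat using (ℕ; _+_; _∸_)
open import Data.Nat.Combinatorics using (_C_)
open import Data.Fin using (Fin)
open import Data.List using (List; length)
open import Data.Integer using (+_)
open import Data.Rational using (ℚ; _*_; _/_)
open import Relation.Binary.PropositionalEquality using (_≡_)

open import Data.Nat as ℕ using (zero; suc; _!; NonZero)
import Data.Nat.Properties as ℕ
open import Data.Nat.Properties using (_!≢0; _!*_!≢0)
open import Data.Nat.Combinatorics using (k![n∸k]!∣n!)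
open import Data.Nat.Combinatorics.Specification using (nCk≡n!/k![n-k]!)
open import Data.Nat.DivMod using (m/n*n≡m)
open import Algebra.Properties.CommutativeSemigroup ℕ.*-commutativeSemigroup
  using (x∙yz≈zx∙y; x∙yz≈yx∙z; xy∙z≈xz∙y; xy∙z≈y∙zx; xy∙z≈y∙xz)
open import Function using (_∘_)
open import Data.Fin.Properties using () renaming (_≟_ to _≟ᶠ_)
open import Data.List using ([]; _∷_; _++_; take; drop)
open import Data.List.Properties using (++-assoc; ++-identityʳ)
open import Data.Integer.Properties using (pos-*)
open import Data.Rational using (fromℚᵘ)
open import Data.Rational.Properties
  using (fromℚᵘ-cong; fromℚᵘ-toℚᵘ; toℚᵘ-fromℚᵘ; toℚᵘ-homo-*; *-zeroˡ; *-zeroʳ)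
import Data.Rational.Unnormalised as ℚᵘ
import Data.Rational.Unnormalised.Properties as ℚᵘ
open import Relation.Nullary using (yes; no; ¬_; contradiction)
open import Relation.Binary.PropositionalEquality
  using (refl; sym; trans; cong; cong₂; module ≡-Reasoning)
open ≡-Reasoning

fromℚᵘ-homo-* : ∀ p q → fromℚᵘ p * fromℚᵘ q ≡ fromℚᵘ (p ℚᵘ.* q)
fromℚᵘ-homo-* p q = trans (sym (fromℚᵘ-toℚᵘ _))
  (fromℚᵘ-cong (ℚᵘ.≃-trans (toℚᵘ-homo-* (fromℚᵘ p) (fromℚᵘ q))
                           (ℚᵘ.*-cong (toℚᵘ-fromℚᵘ p) (toℚᵘ-fromℚᵘ q))))

frac-* : ∀ a b c d → frac a b * frac c d ≡ frac (a ℕ.* c) (b ℕ.* d)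
frac-* a zero    c d       = *-zeroˡ (frac c d)
frac-* a (suc b) c zero    = trans (*-zeroʳ (frac a (suc b)))
  (cong (frac (a ℕ.* c)) (sym (ℕ.*-zeroʳ (suc b))))
frac-* a (suc b) c (suc d) = trans (fromℚᵘ-homo-* (ℚᵘ.mkℚᵘ (+ a) b) (ℚᵘ.mkℚᵘ (+ c) d))
  (cong (λ z → fromℚᵘ (ℚᵘ.mkℚᵘ z _)) (sym (pos-* a c)))

frac-cross : ∀ a b c d .{{_ : NonZero b}} .{{_ : NonZero d}} →
             a ℕ.* d ≡ c ℕ.* b → frac a b ≡ frac c d
frac-cross a (suc b) c (suc d) ad≡cb = fromℚᵘ-cong {ℚᵘ.mkℚᵘ (+ a) b} {ℚᵘ.mkℚᵘ (+ c) d}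
  (ℚᵘ.*≡* (trans (sym (pos-* a (suc d))) (trans (cong +_ ad≡cb) (pos-* c (suc b)))))

prodFrom-cong : ∀ k r {f g : ℕ → ℚ} → (∀ j → f j ≡ g j) → prodFrom k r f ≡ prodFrom k r g
prodFrom-cong k zero    f≗g = refl
prodFrom-cong k (suc r) f≗g = cong₂ _*_ (f≗g k) (prodFrom-cong (suc k) r f≗g)

prodFrom-suc : ∀ k r (f : ℕ → ℚ) → prodFrom (suc k) r f ≡ prodFrom k r (λ j → f (suc j))
prodFrom-suc k zero    f = refl
prodFrom-suc k (suc r) f = cong (f (suc k) *_) (prodFrom-suc (suc k) r f)

risingFactorial : ℕ → ℕ → ℕ
risingFactorial d zero    = 1
risingFactorial d (suc n) = d ℕ.* risingFactorial (suc d) n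

risingFactorial-nonZero : ∀ d n .{{_ : NonZero d}} → NonZero (risingFactorial d n)
risingFactorial-nonZero d zero    = _
risingFactorial-nonZero d (suc n) = ℕ.m*n≢0 d (risingFactorial (suc d) n)
  where
  instance
    rest≢0 : NonZero (risingFactorial (suc d) n)
    rest≢0 = risingFactorial-nonZero (suc d) n

risingFactorial-! : ∀ e n → risingFactorial (suc e) n ℕ.* e ! ≡ (e + n) !
risingFactorial-! e zero    = trans (ℕ.+-identityʳ (e !)) (cong _! (sym (ℕ.+-identityʳ e)))
risingFactorial-! e (suc n) = begin
  suc e ℕ.* risingFactorial (suc (suc e)) n ℕ.* e !
    ≡⟨ xy∙z≈y∙xz (suc e) (risingFactorial (suc (suc e)) n) (e !) ⟩
  risingFactorial (suc (suc e)) n ℕ.* suc e !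
    ≡⟨ risingFactorial-! (suc e) n ⟩
  (suc e + n) !
    ≡⟨ cong _! (ℕ.+-suc e n) ⟨
  (e + suc n) ! ∎

C*!≡risingFactorial : ∀ e n → ((e + n) C n) ℕ.* n ! ≡ risingFactorial (suc e) n
C*!≡risingFactorial e n = ℕ.*-cancelʳ-≡ _ _ (e !) {{e !≢0}} (begin
  ((e + n) C n) ℕ.* n ! ℕ.* e !
    ≡⟨ ℕ.*-assoc ((e + n) C n) (n !) (e !) ⟩
  ((e + n) C n) ℕ.* (n ! ℕ.* e !)
    ≡⟨ cong (λ k → ((e + n) C n) ℕ.* (n ! ℕ.* k !)) (ℕ.m+n∸n≡m e n) ⟨
  ((e + n) C n) ℕ.* (n ! ℕ.* (e + n ∸ n) !)
    ≡⟨ cong (ℕ._* (n ! ℕ.* (e + n ∸ n) !)) (nCk≡n!/k![n-k]! n≤e+n) ⟩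
  ((e + n) ! ℕ./ (n ! ℕ.* (e + n ∸ n) !)) {{n !* (e + n ∸ n) !≢0}} ℕ.* (n ! ℕ.* (e + n ∸ n) !)
    ≡⟨ m/n*n≡m {{n !* (e + n ∸ n) !≢0}} (k![n∸k]!∣n! n≤e+n) ⟩
  (e + n) !
    ≡⟨ risingFactorial-! e n ⟨
  risingFactorial (suc e) n ℕ.* e ! ∎)
  where
  n≤e+n : n ℕ.≤ e + n
  n≤e+n = ℕ.m≤n+m n e

module _ {m : ℕ} where

  atFactor-∷ : ∀ (g : List (Fin m) → Fin m → ℚ) x xs k →
               atFactor g (x ∷ xs) (suc k) ≡ atFactor (λ pre → g (x ∷ pre)) xs k
  atFactor-∷ g x xs k with drop k xs
  ... | []    = refl
  ... | _ ∷ _ = refl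

  atFactor-cong : ∀ {g h : List (Fin m) → Fin m → ℚ} T k →
                  (∀ pre x → g pre x ≡ h pre x) → atFactor g T k ≡ atFactor h T k
  atFactor-cong T k g≗h with drop k T
  ... | []    = refl
  ... | x ∷ _ = g≗h (take k T) x

  count-here : ∀ (σ : Fin m) xs → count σ (σ ∷ xs) ≡ suc (count σ xs)
  count-here σ xs with σ ≟ᶠ σ
  ... | yes _   = refl
  ... | no σ≢σ = contradiction refl σ≢σ

  count-there : ∀ {x σ : Fin m} xs → ¬ x ≡ σ → count σ (x ∷ xs) ≡ count σ xs
  count-there {x} {σ} xs x≢σ with x ≟ᶠ σ
  ... | yes x≡σ = contradiction x≡σ x≢σ
  ... | no _    = refl

  count-++ : ∀ (σ : Fin m) xs ys → count σ (xs ++ ys) ≡ count σ xs + count σ ys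
  count-++ σ []       ys = refl
  count-++ σ (x ∷ xs) ys with x ≟ᶠ σ
  ... | yes _ = cong suc (count-++ σ xs ys)
  ... | no _  = count-++ σ xs ys

  forwardNumerator : List (Fin m) → ℕ
  forwardNumerator []       = 1
  forwardNumerator (x ∷ xs) = count x (x ∷ xs) ℕ.* forwardNumerator xs

  backwardNumerator : List (Fin m) → List (Fin m) → ℕ
  backwardNumerator pre []       = 1
  backwardNumerator pre (y ∷ ys) = (count y pre + 1) ℕ.* backwardNumerator (pre ++ y ∷ []) ys

  -- Appending y raises by one the suffix count of each earlier occurrence of y, so the
  -- factors 1, …, c of y in the forward numerator become 2, …, c + 1.
  count-exchange : ∀ (x y : Fin m) xs →
    (count y xs + 1) ℕ.* (count x (x ∷ xs) + count x (y ∷ []))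
      ≡ count x (x ∷ xs) ℕ.* (count y (x ∷ xs) + 1)
  count-exchange x y xs with y ≟ᶠ x
  ... | yes refl = cong (ℕ._* (count x (x ∷ xs) + 1))
                        (trans (ℕ.+-comm (count x xs) 1) (sym (count-here x xs)))
  ... | no y≢x   = trans (cong₂ ℕ._*_ (cong (_+ 1) (sym (count-there xs (y≢x ∘ sym))))
                                     (ℕ.+-identityʳ (count x (x ∷ xs))))
                         (ℕ.*-comm (count y (x ∷ xs) + 1) (count x (x ∷ xs)))

  forwardNumerator-∷ʳ : ∀ T y →
    forwardNumerator (T ++ y ∷ []) ≡ forwardNumerator T ℕ.* (count y T + 1)
  forwardNumerator-∷ʳ []       y = cong (ℕ._* 1) (count-here y [])
  forwardNumerator-∷ʳ (x ∷ xs) y = begin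
    count x (x ∷ xs ++ y ∷ []) ℕ.* forwardNumerator (xs ++ y ∷ [])
      ≡⟨ cong₂ ℕ._*_ (count-++ x (x ∷ xs) (y ∷ [])) (forwardNumerator-∷ʳ xs y) ⟩
    (count x (x ∷ xs) + count x (y ∷ [])) ℕ.* (forwardNumerator xs ℕ.* (count y xs + 1))
      ≡⟨ x∙yz≈zx∙y _ (forwardNumerator xs) (count y xs + 1) ⟩
    (count y xs + 1) ℕ.* (count x (x ∷ xs) + count x (y ∷ [])) ℕ.* forwardNumerator xs
      ≡⟨ cong (ℕ._* forwardNumerator xs) (count-exchange x y xs) ⟩
    count x (x ∷ xs) ℕ.* (count y (x ∷ xs) + 1) ℕ.* forwardNumerator xs
      ≡⟨ xy∙z≈xz∙y (count x (x ∷ xs)) _ (forwardNumerator xs) ⟩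
    count x (x ∷ xs) ℕ.* forwardNumerator xs ℕ.* (count y (x ∷ xs) + 1) ∎

  backwardNumerator-forwardNumerator : ∀ pre T →
    backwardNumerator pre T ℕ.* forwardNumerator pre ≡ forwardNumerator (pre ++ T)
  backwardNumerator-forwardNumerator pre [] =
    trans (ℕ.*-identityˡ (forwardNumerator pre)) (cong forwardNumerator (sym (++-identityʳ pre)))
  backwardNumerator-forwardNumerator pre (y ∷ ys) = begin
    (count y pre + 1) ℕ.* backwardNumerator (pre ++ y ∷ []) ys ℕ.* forwardNumerator pre
      ≡⟨ xy∙z≈y∙zx (count y pre + 1) _ (forwardNumerator pre) ⟩
    backwardNumerator (pre ++ y ∷ []) ys ℕ.* (forwardNumerator pre ℕ.* (count y pre + 1))
      ≡⟨ cong (backwardNumerator (pre ++ y ∷ []) ys ℕ.*_) (sym (forwardNumerator-∷ʳ pre y)) ⟩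
    backwardNumerator (pre ++ y ∷ []) ys ℕ.* forwardNumerator (pre ++ y ∷ [])
      ≡⟨ backwardNumerator-forwardNumerator (pre ++ y ∷ []) ys ⟩
    forwardNumerator ((pre ++ y ∷ []) ++ ys)
      ≡⟨ cong forwardNumerator (++-assoc pre (y ∷ []) ys) ⟩
    forwardNumerator (pre ++ y ∷ ys) ∎

  backwardNumerator≡forwardNumerator : ∀ T → backwardNumerator [] T ≡ forwardNumerator T
  backwardNumerator≡forwardNumerator T =
    trans (sym (ℕ.*-identityʳ (backwardNumerator [] T))) (backwardNumerator-forwardNumerator [] T)

  rf-∷ : ∀ x xs → rf m (x ∷ xs) ≡ frac (count x (x ∷ xs)) (suc (length xs)) * rf m xs
  rf-∷ x xs = cong (frac (count x (x ∷ xs)) (suc (length xs)) *_)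
    (trans (prodFrom-suc 0 (length xs) _)
           (prodFrom-cong 0 (length xs) λ k → atFactor-∷ _ x xs k))

  rf-closed : ∀ T → rf m T ≡ frac (forwardNumerator T) (length T !)
  rf-closed []       = refl
  rf-closed (x ∷ xs) = begin
    rf m (x ∷ xs)
      ≡⟨ rf-∷ x xs ⟩
    frac (count x (x ∷ xs)) (suc (length xs)) * rf m xs
      ≡⟨ cong (frac (count x (x ∷ xs)) (suc (length xs)) *_) (rf-closed xs) ⟩
    frac (count x (x ∷ xs)) (suc (length xs)) *
      frac (forwardNumerator xs) (length xs !)
      ≡⟨ frac-* (count x (x ∷ xs)) (suc (length xs)) (forwardNumerator xs) (length xs !) ⟩
    frac (forwardNumerator (x ∷ xs)) (length (x ∷ xs) !) ∎

  -- rb m T is backwardWidth [] m T: the backward coder's width on T once the history pre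
  -- has been coded, its first denominator being d.
  backwardWidth : List (Fin m) → ℕ → List (Fin m) → ℚ
  backwardWidth pre d T = prodFrom 0 (length T) λ k →
    atFactor (λ p x → frac (count x (pre ++ p) + 1) (d + k)) T k

  backwardWidth-∷ : ∀ pre d y ys → backwardWidth pre d (y ∷ ys)
    ≡ frac (count y pre + 1) d * backwardWidth (pre ++ y ∷ []) (suc d) ys
  backwardWidth-∷ pre d y ys = cong₂ _*_
    (cong₂ (λ p e → frac (count y p + 1) e) (++-identityʳ pre) (ℕ.+-identityʳ d))
    (trans (prodFrom-suc 0 (length ys) _)
           (prodFrom-cong 0 (length ys) λ k →
              trans (atFactor-∷ _ y ys k) (atFactor-cong ys k λ p x →
                cong₂ (λ q e → frac (count x q + 1) e)
                      (sym (++-assoc pre (y ∷ []) p)) (ℕ.+-suc d k))))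

  backwardWidth-closed : ∀ (pre : List (Fin m)) d T →
    backwardWidth pre d T ≡ frac (backwardNumerator pre T) (risingFactorial d (length T))
  backwardWidth-closed pre d []       = refl
  backwardWidth-closed pre d (y ∷ ys) = begin
    backwardWidth pre d (y ∷ ys)
      ≡⟨ backwardWidth-∷ pre d y ys ⟩
    frac (count y pre + 1) d * backwardWidth (pre ++ y ∷ []) (suc d) ys
      ≡⟨ cong (frac (count y pre + 1) d *_) (backwardWidth-closed (pre ++ y ∷ []) (suc d) ys) ⟩
    frac (count y pre + 1) d *
      frac (backwardNumerator (pre ++ y ∷ []) ys) (risingFactorial (suc d) (length ys))
      ≡⟨ frac-* (count y pre + 1) d (backwardNumerator (pre ++ y ∷ []) ys)
                (risingFactorial (suc d) (length ys)) ⟩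
    frac (backwardNumerator pre (y ∷ ys)) (risingFactorial d (length (y ∷ ys))) ∎

corollary4 : (m : ℕ) (T : List (Fin m)) →
    rf m T ≡ ((+ ((m + length T ∸ 1) C length T)) / 1) * rb m T
corollary4 zero    [] = refl
corollary4 (suc e) T  = begin
  rf (suc e) T
    ≡⟨ rf-closed T ⟩
  frac (forwardNumerator T) (n !)
    ≡⟨ frac-cross (forwardNumerator T) (n !) (K ℕ.* forwardNumerator T) R
                  {{n !≢0}} {{risingFactorial-nonZero (suc e) n}} cross ⟩
  frac (K ℕ.* forwardNumerator T) R
    ≡⟨ cong₂ frac (cong (K ℕ.*_) (backwardNumerator≡forwardNumerator T)) (ℕ.*-identityˡ R) ⟨
  frac (K ℕ.* backwardNumerator [] T) (1 ℕ.* R)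
    ≡⟨ frac-* K 1 (backwardNumerator [] T) R ⟨
  frac K 1 * frac (backwardNumerator [] T) R
    ≡⟨ cong (frac K 1 *_) (backwardWidth-closed [] (suc e) T) ⟨
  ((+ K) / 1) * rb (suc e) T ∎
  where
  n K R : ℕ
  n = length T
  K = (e + n) C n
  R = risingFactorial (suc e) n
  cross : forwardNumerator T ℕ.* R ≡ K ℕ.* forwardNumerator T ℕ.* n !
  cross = trans (cong (forwardNumerator T ℕ.*_) (sym (C*!≡risingFactorial e n)))
                (x∙yz≈yx∙z (forwardNumerator T) K (n !))
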